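{- Let $H$ be a linear hypergraph and $g\ge2$ an integer. Then the following are equivalent: (i) $\mathrm{girth}(H)>g$; (ii) $\mathrm{Girth}(H,E^+(H))>(g,g)$; (iii) $\mathrm{Girth}(H,E^+(H)\cup\{H\})>g$.
   Context: Hypergraphs are pairs $(V,E)$ with $E$ a set of $k$-subsets of a finite set $V$ ($k\ge2$); linear means two distinct edges share at most one vertex. An $n$-cycle ($n\ge2$) is a cyclic sequence $e_1v_1\ldots e_nv_n$ of distinct edges and distinct vertices with $v_i\in e_i\cap e_{i+1}$; $\mathrm{girth}(H)>g$ means no $n$-cycle with $n\in[2,g]$. For $e\in E(H)$, $e^+=(e,\{e\})$ is an edge copy and $E^+(H)=\{e^+:e\in E(H)\}$; for a set $\mathscr{H}$ of subhypergraphs, $\mathscr{H}^+=\mathscr{H}\cup E^+(H)$, and members not in $E^+(H)$ are real copies (so $E^+(H)$ itself is of the form $\mathscr{H}^+$ with $\mathscr{H}=\emptyset$, and $E^+(H)\cup\{H\}=\{H\}^+$). A cycle of copies in a set $\mathscr{S}$ of subhypergraphs is a cyclic sequence $F_1q_1\ldots F_nq_n$, $n\ge2$, with $F_i\in\mathscr{S}$, $F_i\ne F_{i+1}$, connectors $q_i$ distinct elements of $V(H)\cup E(H)$, and: a vertex $q_i$ lies in $V(F_i)\cap V(F_{i+1})$, an edge $q_i$ lies in $E(F_i)\cap E(F_{i+1})$. Index $i$ is pure if $q_{i-1},q_i$ are both vertices or both edges, mixed otherwise; order $=$ #pure$+\frac12$#mixed, length $=n$, $h(\mathscr{C})=(\text{order},\text{length})$,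 compared lexicographically. Tidy: (T1) no connectors $q_i,q_j$ with $q_i\in q_j$; (T2) for every edge $f$, $\{i: q_i$ a vertex in $f\}\subseteq\{i_\star,i_\star+1\}$ for some $i_\star$. A copy $F_\star$ of the cycle is a master copy if there are edges $f_i\in E(F_\star)$ for all $i$ with $F_i\ne F_\star$ such that replacing each such $F_i$ by $f_i^+$ gives again a cycle of copies. $\mathrm{Girth}(H,\mathscr{S})>(g,n)$ means every tidy cycle of copies $\mathscr{C}$ in $\mathscr{S}$ with $h(\mathscr{C})\le(g,n)$ has a master copy; $\mathrm{Girth}(H,\mathscr{S})>g$ means every tidy cycle of copies of order at most $g$ has a master copy. -}

module Defs where

open import Data.Nat using (ℕ; zero; suc; _+_; _*_; _≤_; _<_)
open import Data.Nat.DivMod using (_%_; m%n<n)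
open import Data.Bool using (Bool; true; false; if_then_else_)
open import Data.Fin using (Fin; toℕ; fromℕ<)
open import Data.Fin.Subset using (Subset; _∈_; ∣_∣; ⁅_⁆) renaming (⊤ to full)
open import Data.Sum using (_⊎_; inj₁; inj₂)
open import Data.Product using (_×_; ∃; Σ; _,_)
open import Relation.Binary.PropositionalEquality using (_≡_; _≢_)
open import Relation.Nullary using (¬_)
open import Function.Definitions using (Injective)

next : ∀ {n} → Fin n → Fin n
next {suc n} i = fromℕ< (m%n<n (suc (toℕ i)) (suc n))

prev : ∀ {n} → Fin n → Fin n
prev {suc n} i = fromℕ< (m%n<n (toℕ i + n) (suc n))

sumFin : ∀ {n} → (Fin n → ℕ) → ℕ
sumFin {zero} f = 0
sumFin {suc n} f = f Data.Fin.zero + sumFin (λ i → f (Data.Fin.suc i))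

record Hypergraph : Set where
  field
    N m k     : ℕ
    2≤k       : 2 ≤ k
    edge      : Fin m → Subset N
    edge-inj  : Injective _≡_ _≡_ edge
    edge-size : ∀ e → ∣ edge e ∣ ≡ k

module _ (H : Hypergraph) where
  open Hypergraph H

  Linear : Set
  Linear = ∀ e f → e ≢ f → ∀ u w →
    u ∈ edge e → u ∈ edge f → w ∈ edge e → w ∈ edge f → u ≡ w

  -- n-cycle e₁v₁…eₙvₙ (indices 0..n-1, cyclic)
  IsCycle : (n : ℕ) → (Fin n → Fin m) → (Fin n → Fin N) → Set
  IsCycle n e v = 2 ≤ n × Injective _≡_ _≡_ e × Injective _≡_ _≡_ v
    × (∀ i → v i ∈ edge (e i) × v i ∈ edge (e (next i)))

  girth> : ℕ → Set
  girth> g = ∀ n → 2 ≤ n → n ≤ g → ∀ e v → ¬ IsCycle n e v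

  record SubHG : Set where
    constructor subHG
    field
      V : Subset N
      E : Subset m

  open SubHG

  edgeCopy : Fin m → SubHG
  edgeCopy e = subHG (edge e) ⁅ e ⁆

  wholeH : SubHG
  wholeH = subHG full full

  E⁺ : SubHG → Set
  E⁺ F = ∃ λ e → F ≡ edgeCopy e

  E⁺∪H : SubHG → Set
  E⁺∪H F = E⁺ F ⊎ F ≡ wholeH

  Connector : Set
  Connector = Fin N ⊎ Fin m

  LiesIn : Connector → SubHG → Set
  LiesIn (inj₁ v) F = v ∈ V F
  LiesIn (inj₂ e) F = e ∈ E F

  IsCycleOfCopies : (SubHG → Set) → (n : ℕ) → (Fin n → SubHG) → (Fin n → Connector) → Set
  IsCycleOfCopies 𝒮 n F q = 2 ≤ n × (∀ i → 𝒮 (F i)) × (∀ i → F i ≢ F (next i))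
    × Injective _≡_ _≡_ q × (∀ i → LiesIn (q i) (F i) × LiesIn (q i) (F (next i)))

  sameKind : Connector → Connector → Bool
  sameKind (inj₁ _) (inj₁ _) = true
  sameKind (inj₂ _) (inj₂ _) = true
  sameKind _ _ = false

  -- 2 · order : pure indices weigh 2, mixed indices weigh 1
  twiceOrder : ∀ {n} → (Fin n → Connector) → ℕ
  twiceOrder q = sumFin (λ i → if sameKind (q (prev i)) (q i) then 2 else 1)

  h≤ : ∀ {n} → (Fin n → Connector) → ℕ → ℕ → Set
  h≤ {n} q g n' = twiceOrder q < 2 * g ⊎ (twiceOrder q ≡ 2 * g × n ≤ n')

  Tidy : ∀ {n} → (Fin n → Connector) → Set
  Tidy {n} q =
      (∀ i j v e → q i ≡ inj₁ v → q j ≡ inj₂ e → ¬ (v ∈ edge e))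
    × (∀ f → ∃ λ (i⋆ : Fin n) → ∀ i v → q i ≡ inj₁ v → v ∈ edge f →
         i ≡ i⋆ ⊎ i ≡ next i⋆)

  -- F j is a master copy: replacing each F i ≠ F j by (f i)⁺ with
  -- f i ∈ E(F j) gives again a cycle of copies (same connectors).
  HasMasterCopy : (SubHG → Set) → (n : ℕ) → (Fin n → SubHG) → (Fin n → Connector) → Set
  HasMasterCopy 𝒮 n F q = ∃ λ (j : Fin n) → ∃ λ (f : Fin n → Fin m) →
    ∃ λ (F' : Fin n → SubHG) →
      (∀ i → (F i ≡ F j → F' i ≡ F i)
           × (F i ≢ F j → f i ∈ E (F j) × F' i ≡ edgeCopy (f i)))
      × IsCycleOfCopies 𝒮 n F' q

  Girth>gn : (SubHG → Set) → ℕ → ℕ → Set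
  Girth>gn 𝒮 g n' = ∀ n F q → IsCycleOfCopies 𝒮 n F q → Tidy q → h≤ q g n' →
    HasMasterCopy 𝒮 n F q

  Girth>g : (SubHG → Set) → ℕ → Set
  Girth>g 𝒮 g = ∀ n F q → IsCycleOfCopies 𝒮 n F q → Tidy q → twiceOrder q ≤ 2 * g →
    HasMasterCopy 𝒮 n F q

{-# OPTIONS --safe #-}
-- Two distinct edge copies share no edge, so every connector of a cycle of edge copies is a
-- vertex, and (T2) makes its edges pairwise distinct: a tidy cycle of n edge copies is an
-- n-cycle of H, of order n. It has no master copy, since a master copy x⁺ could only replace
-- its neighbours by x⁺ itself. Conversely, if an edge f meets an n-cycle of H in two
-- non-consecutive positions, walking along the cycle from one to the other and returning
-- through f gives a shorter cycle; hence a shortest cycle satisfies (T2), and its edge copies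
-- form a tidy cycle of copies without master copy. Adding H to E⁺(H) changes nothing, because
-- H is a master copy of every cycle of copies passing through it.
module Submission where

open import Defs
open import Data.Bool using (if_then_else_)
open import Data.Empty using (⊥; ⊥-elim)
open import Data.Fin as Fin using (Fin; toℕ)
open import Data.Fin.Properties using (toℕ-fromℕ<; toℕ-injective; toℕ<n; _≟_; all?; any?; ¬∀⟶∃¬)
open import Data.Fin.Subset using (_∈_)
open import Data.Fin.Subset.Properties using (_∈?_; ∈⊤; x∈⁅x⁆; x∈⁅y⁆⇒x≡y)
open import Data.Nat using (ℕ; zero; suc; _+_; _*_; _∸_; _≤_; _<_; _<?_; z≤n; s≤s; NonZero)
open import Data.Nat.DivMod
  using (_%_; _mod_; %-distribˡ-+; m%n%n≡m%n; m%n<n; m<n⇒m%n≡m; m≤n⇒[n∸m]%m≡n%m; [m+n]%n≡m%n; n%n≡0)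
open import Data.Nat.Induction using (<-rec)
open import Data.Nat.Properties hiding (_≟_)
open import Algebra.Properties.CommutativeSemigroup +-commutativeSemigroup using (x∙yz≈y∙xz)
open import Data.Product using (∃; _×_; _,_; proj₁; proj₂)
open import Data.Sum using (_⊎_; inj₁; inj₂; [_,_])
open import Data.Sum.Properties using (inj₁-injective)
open import Function using (_∘_)
open import Function.Bundles using (_⇔_; mk⇔)
open import Function.Definitions using (Injective)
open import Relation.Nullary using (¬_; Dec; yes; no; contradiction)
open import Relation.Nullary.Decidable using (_→-dec_; _⊎-dec_; decidable-stable)
open import Relation.Binary.PropositionalEquality
  using (_≡_; _≢_; refl; sym; trans; cong; cong₂; subst; subst₂; module ≡-Reasoning)

open ≡-Reasoning

%-absorbʳ : ∀ m n d .{{_ : NonZero d}} → (m + n % d) % d ≡ (m + n) % d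
%-absorbʳ m n d = begin
  (m + n % d) % d          ≡⟨ %-distribˡ-+ m (n % d) d ⟩
  (m % d + n % d % d) % d  ≡⟨ cong (λ x → (m % d + x) % d) (m%n%n≡m%n n d) ⟩
  (m % d + n % d) % d      ≡⟨ %-distribˡ-+ m n d ⟨
  (m + n) % d              ∎

%-absorbˡ : ∀ m n d .{{_ : NonZero d}} → (m % d + n) % d ≡ (m + n) % d
%-absorbˡ m n d = begin
  (m % d + n) % d  ≡⟨ cong (_% d) (+-comm (m % d) n) ⟩
  (n + m % d) % d  ≡⟨ %-absorbʳ n m d ⟩
  (n + m) % d      ≡⟨ cong (_% d) (+-comm n m) ⟩
  (m + n) % d      ∎

-- r + k < 2d, so (r + k) % d is r + k or r + k ∸ d; the latter equals r only if k ≡ d.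
%-fixed⇒≡0 : ∀ {r k d} .{{_ : NonZero d}} → r < d → k < d → (r + k) % d ≡ r → k ≡ 0
%-fixed⇒≡0 {r} {k} {d} r<d k<d fixed with r + k <? d
... | yes r+k<d = +-cancelˡ-≡ r k 0 (begin
  r + k        ≡⟨ m<n⇒m%n≡m r+k<d ⟨
  (r + k) % d  ≡⟨ fixed ⟩
  r            ≡⟨ +-identityʳ r ⟨
  r + 0        ∎)
... | no r+k≮d = contradiction k≡d (<⇒≢ k<d)
  where
  d≤r+k : d ≤ r + k
  d≤r+k = ≮⇒≥ r+k≮d

  r+k∸d<d : r + k ∸ d < d
  r+k∸d<d = ≤-<-trans (∸-monoˡ-≤ d (+-monoʳ-≤ r (<⇒≤ k<d))) (subst (_< d) (sym (m+n∸n≡m r d)) r<d)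

  k≡d : k ≡ d
  k≡d = +-cancelˡ-≡ r k d (begin
    r + k                ≡⟨ m∸n+n≡m d≤r+k ⟨
    r + k ∸ d + d        ≡⟨ cong (_+ d) (m<n⇒m%n≡m r+k∸d<d) ⟨
    (r + k ∸ d) % d + d  ≡⟨ cong (_+ d) (m≤n⇒[n∸m]%m≡n%m d≤r+k) ⟩
    (r + k) % d + d      ≡⟨ cong (_+ d) fixed ⟩
    r + d                ∎)

%-cancelˡ-≤ : ∀ a {x y d} .{{_ : NonZero d}} → x ≤ y → y < d → (a + x) % d ≡ (a + y) % d → x ≡ y
%-cancelˡ-≤ a {x} {d = d} x≤y y<d eq with k , refl ← m≤n⇒∃[o]m+o≡n x≤y =
  sym (trans (cong (x +_) k≡0) (+-identityʳ x))
  where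
  k≡0 : k ≡ 0
  k≡0 = %-fixed⇒≡0 (m%n<n (a + x) d) (≤-<-trans (m≤n+m k x) y<d) (begin
    ((a + x) % d + k) % d  ≡⟨ %-absorbˡ (a + x) k d ⟩
    (a + x + k) % d        ≡⟨ cong (_% d) (+-assoc a x k) ⟩
    (a + (x + k)) % d      ≡⟨ eq ⟨
    (a + x) % d            ∎)

%-cancelˡ : ∀ a {x y d} .{{_ : NonZero d}} → x < d → y < d → (a + x) % d ≡ (a + y) % d → x ≡ y
%-cancelˡ a {x} {y} x<d y<d eq with ≤-total x y
... | inj₁ x≤y = %-cancelˡ-≤ a x≤y y<d eq
... | inj₂ y≤x = sym (%-cancelˡ-≤ a y≤x x<d (sym eq))

infixl 6 _⊕_

_⊕_ : ∀ {n} → Fin (suc n) → ℕ → Fin (suc n)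
_⊕_ {n} a j = (toℕ a + j) mod suc n

module _ {n : ℕ} where

  toℕ-⊕ : ∀ (a : Fin (suc n)) j → toℕ (a ⊕ j) ≡ (toℕ a + j) % suc n
  toℕ-⊕ a j = toℕ-fromℕ< (m%n<n (toℕ a + j) (suc n))

  ⊕-identityʳ : ∀ (a : Fin (suc n)) → a ⊕ 0 ≡ a
  ⊕-identityʳ a = toℕ-injective (begin
    toℕ (a ⊕ 0)          ≡⟨ toℕ-⊕ a 0 ⟩
    (toℕ a + 0) % suc n  ≡⟨ cong (_% suc n) (+-identityʳ (toℕ a)) ⟩
    toℕ a % suc n        ≡⟨ m<n⇒m%n≡m (toℕ<n a) ⟩
    toℕ a                ∎)

  next-⊕ : ∀ (a : Fin (suc n)) j → next (a ⊕ j) ≡ a ⊕ suc j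
  next-⊕ a j = toℕ-injective (begin
    toℕ (next (a ⊕ j))                 ≡⟨ toℕ-fromℕ< (m%n<n (suc (toℕ (a ⊕ j))) (suc n)) ⟩
    (1 + toℕ (a ⊕ j)) % suc n          ≡⟨ cong (λ x → (1 + x) % suc n) (toℕ-⊕ a j) ⟩
    (1 + (toℕ a + j) % suc n) % suc n  ≡⟨ %-absorbʳ 1 (toℕ a + j) (suc n) ⟩
    (1 + (toℕ a + j)) % suc n          ≡⟨ cong (_% suc n) (+-suc (toℕ a) j) ⟨
    (toℕ a + suc j) % suc n            ≡⟨ toℕ-⊕ a (suc j) ⟨
    toℕ (a ⊕ suc j)                    ∎)

  next≡⊕1 : ∀ (a : Fin (suc n)) → next a ≡ a ⊕ 1
  next≡⊕1 a = trans (cong next (sym (⊕-identityʳ a))) (next-⊕ a 0)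

  ⊕-period : ∀ (a : Fin (suc n)) → a ⊕ suc n ≡ a
  ⊕-period a = toℕ-injective (begin
    toℕ (a ⊕ suc n)          ≡⟨ toℕ-⊕ a (suc n) ⟩
    (toℕ a + suc n) % suc n  ≡⟨ [m+n]%n≡m%n (toℕ a) (suc n) ⟩
    toℕ a % suc n            ≡⟨ m<n⇒m%n≡m (toℕ<n a) ⟩
    toℕ a                    ∎)

  ⊕-cancelˡ : ∀ (a : Fin (suc n)) {j k} → j < suc n → k < suc n → a ⊕ j ≡ a ⊕ k → j ≡ k
  ⊕-cancelˡ a {j} {k} j<n k<n eq = %-cancelˡ (toℕ a) j<n k<n (begin
    (toℕ a + j) % suc n  ≡⟨ toℕ-⊕ a j ⟨
    toℕ (a ⊕ j)          ≡⟨ cong toℕ eq ⟩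
    toℕ (a ⊕ k)          ≡⟨ toℕ-⊕ a k ⟩
    (toℕ a + k) % suc n  ∎)

  ⊕-reach : ∀ (a b : Fin (suc n)) → ∃ λ d → d < suc n × a ⊕ d ≡ b
  ⊕-reach a b = d , m%n<n (toℕ b + (suc n ∸ toℕ a)) (suc n) , toℕ-injective (begin
    toℕ (a ⊕ d)                                  ≡⟨ toℕ-⊕ a d ⟩
    (toℕ a + d) % suc n                          ≡⟨ %-absorbʳ (toℕ a) _ (suc n) ⟩
    (toℕ a + (toℕ b + (suc n ∸ toℕ a))) % suc n  ≡⟨ cong (_% suc n) (x∙yz≈y∙xz (toℕ a) (toℕ b) _) ⟩
    (toℕ b + (toℕ a + (suc n ∸ toℕ a))) % suc n  ≡⟨ cong (λ x → (toℕ b + x) % suc n) a+[n∸a]≡n ⟩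
    (toℕ b + suc n) % suc n                      ≡⟨ [m+n]%n≡m%n (toℕ b) (suc n) ⟩
    toℕ b % suc n                                ≡⟨ m<n⇒m%n≡m (toℕ<n b) ⟩
    toℕ b                                        ∎)
    where
    d : ℕ
    d = (toℕ b + (suc n ∸ toℕ a)) % suc n

    a+[n∸a]≡n : toℕ a + (suc n ∸ toℕ a) ≡ suc n
    a+[n∸a]≡n = m+[n∸m]≡n (<⇒≤ (toℕ<n a))

  next-surjective : ∀ (c : Fin (suc n)) → ∃ λ a → next a ≡ c
  next-surjective c = c ⊕ n , trans (next-⊕ c n) (⊕-period c)

  next-cases : ∀ (i : Fin (suc n)) → toℕ (next i) ≡ suc (toℕ i) ⊎ (next i ≡ Fin.zero × toℕ i ≡ n)
  next-cases i with m≤n⇒m<n∨m≡n (toℕ<n i)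
  ... | inj₁ 1+i<n = inj₁ (trans (toℕ-fromℕ< _) (m<n⇒m%n≡m 1+i<n))
  ... | inj₂ 1+i≡n = inj₂ (toℕ-injective toℕ-next≡0 , suc-injective 1+i≡n)
    where
    toℕ-next≡0 : toℕ (next i) ≡ 0
    toℕ-next≡0 = trans (toℕ-fromℕ< _) (trans (cong (_% suc n) 1+i≡n) (n%n≡0 (suc n)))

next≢id : ∀ {n} → 2 ≤ n → ∀ (a : Fin n) → next a ≢ a
next≢id {suc n} 2≤n a next≡a = 1+n≢0 (⊕-cancelˡ a 2≤n (s≤s z≤n) (begin
  a ⊕ 1   ≡⟨ next≡⊕1 a ⟨
  next a  ≡⟨ next≡a ⟩
  a       ≡⟨ ⊕-identityʳ a ⟨
  a ⊕ 0   ∎))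

sumFin-cong : ∀ {n} {f g : Fin n → ℕ} → (∀ i → f i ≡ g i) → sumFin f ≡ sumFin g
sumFin-cong {zero}  _   = refl
sumFin-cong {suc n} f≗g = cong₂ _+_ (f≗g Fin.zero) (sumFin-cong (f≗g ∘ Fin.suc))

sumFin-const : ∀ n c → sumFin {n} (λ _ → c) ≡ c * n
sumFin-const zero    c = sym (*-zeroʳ c)
sumFin-const (suc n) c = trans (cong (c +_) (sumFin-const n c)) (sym (*-suc c n))

∀⊎∃ : ∀ {n} {A B : Fin n → Set} → (∀ i → A i ⊎ B i) → (∀ i → A i) ⊎ ∃ B
∀⊎∃ {zero}  _ = inj₁ λ ()
∀⊎∃ {suc n} a⊎b with a⊎b Fin.zero | ∀⊎∃ (a⊎b ∘ Fin.suc)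
... | inj₂ b0 | _             = inj₂ (Fin.zero , b0)
... | inj₁ _  | inj₂ (i , bi) = inj₂ (Fin.suc i , bi)
... | inj₁ a0 | inj₁ as       = inj₁ λ { Fin.zero → a0 ; (Fin.suc i) → as i }

module _ (H : Hypergraph) where
  open Hypergraph H

  Chordless : ∀ {n} → (Fin n → Fin N) → Set
  Chordless {n} v = ∀ f → ∃ λ (i⋆ : Fin n) → ∀ i → v i ∈ edge f → i ≡ i⋆ ⊎ i ≡ next i⋆

  Chord : ∀ {n} → (Fin n → Fin N) → Fin m → Set
  Chord {n} v f = ∀ (i⋆ : Fin n) → ∃ λ i → v i ∈ edge f × i ≢ i⋆ × i ≢ next i⋆

  private
    consecutive? : ∀ {n} (v : Fin n → Fin N) f i⋆ i → Dec (v i ∈ edge f → i ≡ i⋆ ⊎ i ≡ next i⋆)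
    consecutive? v f i⋆ i = (v i ∈? edge f) →-dec (i ≟ i⋆ ⊎-dec i ≟ next i⋆)

  chordless-or-chord : ∀ {n} (v : Fin n → Fin N) → Chordless v ⊎ ∃ (Chord v)
  chordless-or-chord {n} v with all? (λ f → any? (λ i⋆ → all? (consecutive? v f i⋆)))
  ... | yes chordless = inj₁ chordless
  ... | no ¬chordless = inj₂ (f , chord)
    where
    counterexample = ¬∀⟶∃¬ m _ (λ f → any? (λ i⋆ → all? (consecutive? v f i⋆))) ¬chordless
    f = proj₁ counterexample

    chord : Chord v f
    chord i⋆ = i , vi∈f , (λ i≡i⋆ → ¬within (λ _ → inj₁ i≡i⋆))
               , (λ i≡next → ¬within (λ _ → inj₂ i≡next))
      where
      outlier = ¬∀⟶∃¬ n _ (consecutive? v f i⋆) (λ within → proj₂ counterexample (i⋆ , within))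
      i = proj₁ outlier
      ¬within = proj₂ outlier
      vi∈f = decidable-stable (v i ∈? edge f) (λ vi∉f → ¬within (λ vi∈f → contradiction vi∈f vi∉f))

  ShorterCycle : ℕ → Set
  ShorterCycle n = ∃ λ k → k < n ×
    ∃ λ (e : Fin k → Fin m) → ∃ λ (v : Fin k → Fin N) → IsCycle H k e v

  shortcut : ∀ {n e v} → IsCycle H (suc n) e v → ∀ f b d → 1 ≤ d → d < n →
    v b ∈ edge f → v (b ⊕ d) ∈ edge f → (∀ j → 1 ≤ j → j ≤ d → e (b ⊕ j) ≢ f) →
    ShorterCycle (suc n)
  shortcut {n} {e} {v} (_ , e-inj , v-inj , incident) f b d 1≤d d<n vb∈f vbd∈f f∉walk =
    suc d , s≤s d<n , e′ , v′ , s≤s 1≤d , e′-inj , v′-inj , λ j → v′∈e′ j , v′∈e′-next j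
    where
    e′ : Fin (suc d) → Fin m
    e′ Fin.zero    = f
    e′ (Fin.suc j) = e (b ⊕ toℕ (Fin.suc j))

    v′ : Fin (suc d) → Fin N
    v′ j = v (b ⊕ toℕ j)

    walk-injective : ∀ {j k : Fin (suc d)} → b ⊕ toℕ j ≡ b ⊕ toℕ k → j ≡ k
    walk-injective {j} {k} = toℕ-injective ∘ ⊕-cancelˡ b (bounded j) (bounded k)
      where
      bounded : ∀ (j : Fin (suc d)) → toℕ j < suc n
      bounded j = <-trans (toℕ<n j) (s≤s d<n)

    v′-inj : Injective _≡_ _≡_ v′
    v′-inj = walk-injective ∘ v-inj

    f∉e′ : ∀ j → e′ (Fin.suc j) ≢ f
    f∉e′ j = f∉walk (suc (toℕ j)) (s≤s z≤n) (toℕ<n j)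

    e′-inj : Injective _≡_ _≡_ e′
    e′-inj {Fin.zero}  {Fin.zero}  _  = refl
    e′-inj {Fin.zero}  {Fin.suc k} eq = contradiction (sym eq) (f∉e′ k)
    e′-inj {Fin.suc j} {Fin.zero}  eq = contradiction eq (f∉e′ j)
    e′-inj {Fin.suc j} {Fin.suc k} eq = walk-injective (e-inj eq)

    e′-step : ∀ (j : Fin (suc d)) {t} → toℕ j ≡ suc t → e′ j ≡ e (next (b ⊕ t))
    e′-step (Fin.suc j) refl = cong e (sym (next-⊕ b (toℕ j)))

    v′∈e′ : ∀ j → v′ j ∈ edge (e′ j)
    v′∈e′ Fin.zero    = subst (λ x → v x ∈ edge f) (sym (⊕-identityʳ b)) vb∈f
    v′∈e′ (Fin.suc j) = proj₁ (incident (b ⊕ toℕ (Fin.suc j)))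

    v′∈e′-next : ∀ j → v′ j ∈ edge (e′ (next j))
    v′∈e′-next j with next-cases j
    ... | inj₁ steps =
      subst (λ x → v′ j ∈ edge x) (sym (e′-step (next j) steps)) (proj₂ (incident (b ⊕ toℕ j)))
    ... | inj₂ (wraps , j≡d) =
      subst (λ x → v′ j ∈ edge (e′ x)) (sym wraps)
        (subst (λ t → v (b ⊕ t) ∈ edge f) (sym j≡d) vbd∈f)

  chord-shortcut : ∀ {n e v} → IsCycle H (suc n) e v → ∀ f a b → v a ∈ edge f → v b ∈ edge f →
    b ≢ a → b ≢ next a → f ≡ e (next a) ⊎ (∀ c → e c ≢ f) → ShorterCycle (suc n)
  chord-shortcut {n} {e} {v} cycle@(_ , e-inj , _) f a b va∈f vb∈f b≢a b≢next-a f-off-walk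
    with d , d<1+n , b⊕d≡a ← ⊕-reach b a =
    shortcut cycle f b d 1≤d d<n vb∈f (subst (λ x → v x ∈ edge f) (sym b⊕d≡a) va∈f)
      (f∉walk f-off-walk)
    where
    1≤d : 1 ≤ d
    1≤d = n≢0⇒n>0 λ d≡0 → b≢a (begin
      b      ≡⟨ ⊕-identityʳ b ⟨
      b ⊕ 0  ≡⟨ cong (b ⊕_) d≡0 ⟨
      b ⊕ d  ≡⟨ b⊕d≡a ⟩
      a      ∎)

    d<n : d < n
    d<n = ≤∧≢⇒< (≤-pred d<1+n) λ d≡n → b≢next-a (begin
      b             ≡⟨ ⊕-period b ⟨
      b ⊕ suc n     ≡⟨ cong (λ x → b ⊕ suc x) d≡n ⟨
      b ⊕ suc d     ≡⟨ next-⊕ b d ⟨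
      next (b ⊕ d)  ≡⟨ cong next b⊕d≡a ⟩
      next a        ∎)

    f∉walk : f ≡ e (next a) ⊎ (∀ c → e c ≢ f) → ∀ j → 1 ≤ j → j ≤ d → e (b ⊕ j) ≢ f
    f∉walk (inj₂ f∉e) j _ _ = f∉e (b ⊕ j)
    f∉walk (inj₁ f≡e-next-a) j _ j≤d e[b⊕j]≡f =
      <⇒≢ (s≤s j≤d) (⊕-cancelˡ b (≤-<-trans j≤d d<1+n) (s≤s d<n) (e-inj (begin
        e (b ⊕ j)         ≡⟨ e[b⊕j]≡f ⟩
        f                 ≡⟨ f≡e-next-a ⟩
        e (next a)        ≡⟨ cong (e ∘ next) b⊕d≡a ⟨
        e (next (b ⊕ d))  ≡⟨ cong e (next-⊕ b d) ⟩
        e (b ⊕ suc d)     ∎)))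

  chord⇒shorter : ∀ {n e v} → IsCycle H (suc n) e v → ∀ {f} → Chord v f → ShorterCycle (suc n)
  chord⇒shorter {n} {e} {v} cycle@(_ , _ , _ , incident) {f} chord with any? (λ c → e c ≟ f)
  ... | yes (c , ec≡f) =
    let (a , next-a≡c) = next-surjective c
        (b , vb∈f , b≢a , b≢next-a) = chord a
        e-next-a≡f = trans (cong e next-a≡c) ec≡f
        va∈f = subst (λ x → v a ∈ edge x) e-next-a≡f (proj₂ (incident a))
    in chord-shortcut cycle f a b va∈f vb∈f b≢a b≢next-a (inj₁ (sym e-next-a≡f))
  ... | no f∉e =
    let (a , va∈f , _) = chord Fin.zero
        (b , vb∈f , b≢a , b≢next-a) = chord a
    in chord-shortcut cycle f a b va∈f vb∈f b≢a b≢next-a (inj₂ λ c ec≡f → f∉e (c , ec≡f))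

  ChordlessCycleWithin : ℕ → Set
  ChordlessCycleWithin n = ∃ λ k → k ≤ n ×
    ∃ λ (e : Fin k → Fin m) → ∃ λ (v : Fin k → Fin N) → IsCycle H k e v × Chordless v

  chordless-cycle : ∀ n {e v} → IsCycle H n e v → ChordlessCycleWithin n
  chordless-cycle = <-rec (λ n → ∀ {e v} → IsCycle H n e v → ChordlessCycleWithin n) shorten
    where
    shorten : ∀ n → (∀ {k} → k < n → ∀ {e v} → IsCycle H k e v → ChordlessCycleWithin k) →
      ∀ {e v} → IsCycle H n e v → ChordlessCycleWithin n
    shorten zero _ (() , _)
    shorten (suc n) rec {e} {v} cycle with chordless-or-chord v
    ... | inj₁ chordless = suc n , ≤-refl , e , v , cycle , chordless
    ... | inj₂ (_ , chord) =
      let (k , k<n , _ , _ , shorter) = chord⇒shorter cycle chord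
          (k′ , k′≤k , chordless′) = rec k<n shorter
      in k′ , ≤-trans k′≤k (<⇒≤ k<n) , chordless′

  IsVertex : Connector H → Set
  IsVertex c = ∃ λ u → c ≡ inj₁ u

  twiceOrder-vertices : ∀ {n} (q : Fin n → Connector H) → (∀ i → IsVertex (q i)) →
    twiceOrder H q ≡ 2 * n
  twiceOrder-vertices {n} q vertices = begin
    twiceOrder H q        ≡⟨ sumFin-cong (λ i → pure (vertices (prev i)) (vertices i)) ⟩
    sumFin {n} (λ _ → 2)  ≡⟨ sumFin-const n 2 ⟩
    2 * n                 ∎
    where
    pure : ∀ {c d} → IsVertex c → IsVertex d → (if sameKind H c d then 2 else 1) ≡ 2
    pure (_ , refl) (_ , refl) = refl

  h≤-intro : ∀ {n g} {q : Fin n → Connector H} → twiceOrder H q ≡ 2 * n → n ≤ g → h≤ H q g g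
  h≤-intro {n} {g} order≡2n n≤g with m≤n⇒m<n∨m≡n (*-monoʳ-≤ 2 n≤g)
  ... | inj₁ 2n<2g = inj₁ (subst (_< 2 * g) (sym order≡2n) 2n<2g)
  ... | inj₂ 2n≡2g = inj₂ (trans order≡2n 2n≡2g , n≤g)

  edgeCopy-injective : Injective _≡_ _≡_ (edgeCopy H)
  edgeCopy-injective {x} {y} x⁺≡y⁺ =
    x∈⁅y⁆⇒x≡y y (subst (λ G → x ∈ SubHG.E G) x⁺≡y⁺ (x∈⁅x⁆ x))

  shared-isVertex : ∀ {x y} c → LiesIn H c (edgeCopy H x) → LiesIn H c (edgeCopy H y) → x ≢ y →
    IsVertex c
  shared-isVertex (inj₁ u) _ _ _ = u , refl
  shared-isVertex {x} {y} (inj₂ z) z∈x⁺ z∈y⁺ x≢y =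
    contradiction (trans (sym (x∈⁅y⁆⇒x≡y x z∈x⁺)) (x∈⁅y⁆⇒x≡y y z∈y⁺)) x≢y

  IsCycleOfCopies-mono : ∀ {𝒮 𝒯 : SubHG H → Set} → (∀ {F} → 𝒮 F → 𝒯 F) →
    ∀ {n F q} → IsCycleOfCopies H 𝒮 n F q → IsCycleOfCopies H 𝒯 n F q
  IsCycleOfCopies-mono 𝒮⊆𝒯 (2≤n , members , rest) = 2≤n , (λ i → 𝒮⊆𝒯 (members i)) , rest

  edgeCopyCycle-vertices : ∀ {n F q} → IsCycleOfCopies H (E⁺ H) n F q → ∀ i → IsVertex (q i)
  edgeCopyCycle-vertices {F = F} {q} (_ , copies , adjacent , _ , lies) i =
    shared-isVertex (q i) (subst (LiesIn H (q i)) Fi≡x⁺ (proj₁ (lies i)))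
      (subst (LiesIn H (q i)) F-next≡y⁺ (proj₂ (lies i))) x≢y
    where
    x = proj₁ (copies i)
    Fi≡x⁺ = proj₂ (copies i)
    y = proj₁ (copies (next i))
    F-next≡y⁺ = proj₂ (copies (next i))

    x≢y : x ≢ y
    x≢y x≡y = adjacent i (begin
      F i           ≡⟨ Fi≡x⁺ ⟩
      edgeCopy H x  ≡⟨ cong (edgeCopy H) x≡y ⟩
      edgeCopy H y  ≡⟨ F-next≡y⁺ ⟨
      F (next i)    ∎)

  edgeCopyCycle⇒cycle : ∀ {n F q} → IsCycleOfCopies H (E⁺ H) n F q → Tidy H q →
    ∃ λ (e : Fin n → Fin m) → ∃ λ (v : Fin n → Fin N) → IsCycle H n e v
  edgeCopyCycle⇒cycle {n} {F} {q} copyCycle@(2≤n , copies , adjacent , q-inj , lies) (_ , consecutive) =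
    e , v , 2≤n , e-inj , v-inj , incident
    where
    e : Fin n → Fin m
    e i = proj₁ (copies i)

    vertices = edgeCopyCycle-vertices copyCycle

    v : Fin n → Fin N
    v i = proj₁ (vertices i)

    incident : ∀ i → v i ∈ edge (e i) × v i ∈ edge (e (next i))
    incident i = subst₂ (LiesIn H) (proj₂ (vertices i)) (proj₂ (copies i)) (proj₁ (lies i))
               , subst₂ (LiesIn H) (proj₂ (vertices i)) (proj₂ (copies (next i))) (proj₂ (lies i))

    v-inj : Injective _≡_ _≡_ v
    v-inj {i} {j} vi≡vj = q-inj (begin
      q i         ≡⟨ proj₂ (vertices i) ⟩
      inj₁ (v i)  ≡⟨ cong inj₁ vi≡vj ⟩
      inj₁ (v j)  ≡⟨ proj₂ (vertices j) ⟨
      q j         ∎)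

    e-adjacent : ∀ i → e i ≢ e (next i)
    e-adjacent i ei≡e-next = adjacent i (begin
      F i                      ≡⟨ proj₂ (copies i) ⟩
      edgeCopy H (e i)         ≡⟨ cong (edgeCopy H) ei≡e-next ⟩
      edgeCopy H (e (next i))  ≡⟨ proj₂ (copies (next i)) ⟨
      F (next i)               ∎)

    v∈shared-edge : ∀ {i j} → e i ≡ e j → v j ∈ edge (e i)
    v∈shared-edge {j = j} ei≡ej = subst (λ x → v j ∈ edge x) (sym ei≡ej) (proj₁ (incident j))

    e-inj : Injective _≡_ _≡_ e
    e-inj {i} {j} ei≡ej with consecutive (e i)
    ... | i⋆ , within
        with within i (v i) (proj₂ (vertices i)) (proj₁ (incident i))
           | within j (v j) (proj₂ (vertices j)) (v∈shared-edge ei≡ej)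
    ... | inj₁ i≡i⋆   | inj₁ j≡i⋆   = trans i≡i⋆ (sym j≡i⋆)
    ... | inj₂ i≡next | inj₂ j≡next = trans i≡next (sym j≡next)
    ... | inj₁ i≡i⋆   | inj₂ j≡next =
      contradiction (trans ei≡ej (cong e (trans j≡next (cong next (sym i≡i⋆))))) (e-adjacent i)
    ... | inj₂ i≡next | inj₁ j≡i⋆   =
      contradiction (trans (sym ei≡ej) (cong e (trans i≡next (cong next (sym j≡i⋆))))) (e-adjacent j)

  cycle⇒edgeCopyCycle : ∀ {n e v} → IsCycle H n e v →
    IsCycleOfCopies H (E⁺ H) n (edgeCopy H ∘ e) (inj₁ ∘ v)
  cycle⇒edgeCopyCycle (2≤n , e-inj , v-inj , incident) =
    2≤n , (λ i → _ , refl) , (λ i → next≢id 2≤n i ∘ sym ∘ e-inj ∘ edgeCopy-injective)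
        , v-inj ∘ inj₁-injective , incident

  chordless⇒tidy : ∀ {n} {v : Fin n → Fin N} → Chordless v → Tidy H (inj₁ ∘ v)
  chordless⇒tidy chordless = (λ { _ _ _ _ _ () }) , λ f →
    let (i⋆ , within) = chordless f in i⋆ , λ { i _ refl → within i }

  edgeCopyCycle-noMaster : ∀ {𝒮 n F q} → IsCycleOfCopies H (E⁺ H) n F q → ¬ HasMasterCopy H 𝒮 n F q
  edgeCopyCycle-noMaster {F = F} (_ , copies , adjacent , _)
                                 (j , f , F′ , replaced , (_ , _ , adjacent′ , _)) =
    adjacent′ j (begin
      F′ j                     ≡⟨ proj₁ (replaced j) refl ⟩
      F j                      ≡⟨ Fj≡x⁺ ⟩
      edgeCopy H x             ≡⟨ cong (edgeCopy H) f-next≡x ⟨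
      edgeCopy H (f (next j))  ≡⟨ proj₂ replaced-next ⟨
      F′ (next j)              ∎)
    where
    x = proj₁ (copies j)
    Fj≡x⁺ = proj₂ (copies j)
    replaced-next = proj₂ (replaced (next j)) (adjacent j ∘ sym)
    f-next≡x = x∈⁅y⁆⇒x≡y x (subst (λ G → f (next j) ∈ SubHG.E G) Fj≡x⁺ (proj₁ replaced-next))

  whole-isMaster : ∀ {n F q} → IsCycleOfCopies H (E⁺∪H H) n F q → ∀ j → F j ≡ wholeH H →
    HasMasterCopy H (E⁺∪H H) n F q
  whole-isMaster {n} {F} copyCycle@(_ , members , adjacent , _) j Fj≡H =
    j , f , F , (λ i → (λ _ → refl) , λ Fi≢Fj → f∈Fj i , edgeCopy-of (members i) Fi≢Fj) , copyCycle
    where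
    -- f matters only where F i ≢ F j; elsewhere any edge will do, and F (next j) supplies one.
    some-edge : Fin m
    some-edge with members (next j)
    ... | inj₁ (x , _)  = x
    ... | inj₂ F-next≡H = contradiction (trans Fj≡H (sym F-next≡H)) (adjacent j)

    edge-of : ∀ {G} → E⁺∪H H G → Fin m
    edge-of (inj₁ (x , _)) = x
    edge-of (inj₂ _)       = some-edge

    f : Fin n → Fin m
    f i = edge-of (members i)

    f∈Fj : ∀ i → f i ∈ SubHG.E (F j)
    f∈Fj i = subst (λ G → f i ∈ SubHG.E G) (sym Fj≡H) ∈⊤

    edgeCopy-of : ∀ {i} (p : E⁺∪H H (F i)) → F i ≢ F j → F i ≡ edgeCopy H (edge-of p)
    edgeCopy-of (inj₁ (_ , Fi≡x⁺)) _     = Fi≡x⁺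
    edgeCopy-of (inj₂ Fi≡H)        Fi≢Fj = contradiction (trans Fi≡H (sym Fj≡H)) Fi≢Fj

  cycle⇒tidyEdgeCopyCycle : ∀ {n e v} → IsCycle H n e v → ∃ λ k → k ≤ n ×
    ∃ λ (e′ : Fin k → Fin m) → ∃ λ (v′ : Fin k → Fin N) →
      IsCycleOfCopies H (E⁺ H) k (edgeCopy H ∘ e′) (inj₁ ∘ v′) × Tidy H (inj₁ ∘ v′)
  cycle⇒tidyEdgeCopyCycle {n} cycle =
    let (k , k≤n , e′ , v′ , cycle′ , chordless) = chordless-cycle n cycle
    in k , k≤n , e′ , v′ , cycle⇒edgeCopyCycle cycle′ , chordless⇒tidy chordless

  module _ (g : ℕ) where

    girth>⇒noTidyEdgeCopyCycle : girth> H g → ∀ {n F q} → IsCycleOfCopies H (E⁺ H) n F q →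
      Tidy H q → twiceOrder H q ≤ 2 * g → ⊥
    girth>⇒noTidyEdgeCopyCycle girth {n} {q = q} copyCycle tidy order≤2g =
      let (e , v , cycle) = edgeCopyCycle⇒cycle copyCycle tidy
      in girth n (proj₁ copyCycle) n≤g e v cycle
      where
      order≡2n = twiceOrder-vertices q (edgeCopyCycle-vertices copyCycle)
      n≤g : n ≤ g
      n≤g = *-cancelˡ-≤ 2 (subst (_≤ 2 * g) order≡2n order≤2g)

    girth⇒Girth>gn : girth> H g → Girth>gn H (E⁺ H) g g
    girth⇒Girth>gn girth _ _ _ copyCycle tidy h≤gg =
      ⊥-elim (girth>⇒noTidyEdgeCopyCycle girth copyCycle tidy ([ <⇒≤ , ≤-reflexive ∘ proj₁ ] h≤gg))

    girth⇒Girth>g : girth> H g → Girth>g H (E⁺∪H H) g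
    girth⇒Girth>g girth _ _ _ copyCycle@(2≤n , members , rest) tidy order≤2g with ∀⊎∃ members
    ... | inj₁ copies     = ⊥-elim (girth>⇒noTidyEdgeCopyCycle girth (2≤n , copies , rest) tidy order≤2g)
    ... | inj₂ (j , Fj≡H) = whole-isMaster copyCycle j Fj≡H

    Girth>gn⇒girth : Girth>gn H (E⁺ H) g g → girth> H g
    Girth>gn⇒girth Girth n _ n≤g _ _ cycle =
      let (k , k≤n , _ , v′ , copyCycle , tidy) = cycle⇒tidyEdgeCopyCycle cycle
          order≡2k = twiceOrder-vertices (inj₁ ∘ v′) (λ i → v′ i , refl)
      in edgeCopyCycle-noMaster {E⁺ H} copyCycle
           (Girth k _ _ copyCycle tidy (h≤-intro {q = inj₁ ∘ v′} order≡2k (≤-trans k≤n n≤g)))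

    Girth>g⇒girth : Girth>g H (E⁺∪H H) g → girth> H g
    Girth>g⇒girth Girth n _ n≤g _ _ cycle =
      let (k , k≤n , _ , v′ , copyCycle , tidy) = cycle⇒tidyEdgeCopyCycle cycle
          order≡2k = twiceOrder-vertices (inj₁ ∘ v′) (λ i → v′ i , refl)
          order≤2g = subst (_≤ 2 * g) (sym order≡2k) (*-monoʳ-≤ 2 (≤-trans k≤n n≤g))
      in edgeCopyCycle-noMaster {E⁺∪H H} copyCycle
           (Girth k _ _ (IsCycleOfCopies-mono {𝒯 = E⁺∪H H} inj₁ copyCycle) tidy order≤2g)

lemma4p12 : (H : Hypergraph) → Linear H → (g : ℕ) → 2 ≤ g →
    (girth> H g ⇔ Girth>gn H (E⁺ H) g g)
    × (girth> H g ⇔ Girth>g H (E⁺∪H H) g)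
lemma4p12 H _ g _ =
    mk⇔ (girth⇒Girth>gn H g) (Girth>gn⇒girth H g)
  , mk⇔ (girth⇒Girth>g H g) (Girth>g⇒girth H g)
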